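{- Let $n\ge3$. For a configuration $c$ recurrent for the SSM on $W_n$, define $\Phi_W(c)=(\mathcal{O},M)$ where $\mathcal{O}=\mathcal{O}(m(c))$ and $M$ is the set of $i\in[n]$ with $c_i=2$ such that $i$ is not a cyclically first maximal vertex of $c$. Then $\Phi_W$ is a bijection from the set of recurrent configurations for the SSM on $W_n$ to the set of properly-marked orientations of $C_n$. Moreover, for each such $c$, $\mathrm{level}(c)=|M|$ and $\mathrm{weight}^{01^*}(c)$ equals the number of clockwise edges of $\mathcal{O}$.
   Context: $C_n$ has vertex set $[n]$ and edges $\{i,i+1\}$ ($i\in[n-1]$) and $\{n,1\}$; vertices are indexed modulo $n$ and arranged clockwise; an edge oriented $i\to i+1$ is clockwise, $i+1\to i$ counter-clockwise. $W_n$ has vertex set $\{0,\dots,n\}$, the edges of $C_n$, and edges $\{0,i\}$ for all $i$; $0$ is the sink. For $i\ne j$, $(i,j)$ denotes the vertices strictly between $i$ and $j$ going clockwise from $i$. SSM with parameter $p\in(0,1)$ on $W_n$: configurations $c\in\mathbb{Z}_{\ge0}^n$, stable if $c_i<3$ for all $i$; toppling an unstable $i$ sends, for each neighbour $j$ independently, one grain from $i$ to $j$ with probability $p$ (lost if $j=0$), else keeps it; repeated toppling stabilises. With a distribution $\mu$ on $[n]$, all $\mu_i>0$, the Markov chain on stable configurations adds a grain at $i$ with probability $\mu_i$ and stabilises; recurrent configurations are its recurrent states; minimal recurrent ones are those minimal for the pointwise order among recurrent ones. The level of $c$ is $\sum_ic_i-n$. For recurrent $c$: $i$ is a cyclically first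 maximal vertex if $c_i=2$ and there is $j$ with $c_j=0$ and $c_k=1$ for all $k\in(j,i)$. $m(c)_i=0$ if $c_i=0$, $2$ if $i$ is cyclically first maximal, $1$ otherwise ($m(c)$ is minimal recurrent). A $01^*$-chain of $c$ is a set of cyclically consecutive vertices $j,\dots,j+\ell$ ($\ell\ge0$) with $c_j=0$ and $c_{j'}=1$ for $j<j'\le j+\ell$; $\mathrm{weight}^{01^*}(c)$ is the number of vertices in some $01^*$-chain. For minimal recurrent $c'$, $\mathcal{O}(c')$ is the counter-clockwise directed cycle if $c'=(1,\dots,1)$, and otherwise the unique orientation of $C_n$ in which each vertex $i$ has in-degree $c'_i$. A properly-marked orientation of $C_n$ is a pair $(\mathcal{O},M)$ with $\mathcal{O}$ an orientation of $C_n$ containing at least one counter-clockwise edge and $M\subseteq[n]$ such that every $i\in M$ satisfies $i+1\to i\to i-1$ in $\mathcal{O}$. -}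

module Defs where

open import Data.Nat using (ℕ; zero; suc; _+_; _∸_; _<_; _≤_; _<?_; _≟_)
open import Data.Nat.DivMod using (_%_; m%n<n)
open import Data.Fin using (Fin; toℕ; fromℕ<)
import Data.Fin.Properties as FinP
open import Data.Bool using (Bool; true; false; if_then_else_)
open import Data.Vec using (Vec; lookup; updateAt; replicate; tabulate; sum; count; allFin; []; _∷_)
import Data.Vec.Properties as VecP
open import Data.Fin.Subset using (Subset; _∈_; ∣_∣)
open import Data.List using (List; filter)
import Data.List as List
open import Data.Product using (Σ; ∃; _×_; _,_; proj₁; proj₂)
open import Data.Sum using (_⊎_)
open import Data.Integer as ℤ using (ℤ; +_)
open import Relation.Binary.PropositionalEquality using (_≡_; _≢_)
open import Relation.Binary.Construct.Closure.ReflexiveTransitive using (Star)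
open import Relation.Nullary using (¬_; Dec; does; _×-dec_; _⊎-dec_; ¬?; _→-dec_)
open import Relation.Unary using (Decidable)

-- The cycle C_n.  Vertex k ∈ [n] of the paper is  Fin n  element k-1.
-- Clockwise successor / predecessor (indices modulo n).

next : ∀ {n} → Fin n → Fin n
next {suc m} i = fromℕ< (m%n<n (suc (toℕ i)) (suc m))

prev : ∀ {n} → Fin n → Fin n
prev {suc m} i = fromℕ< (m%n<n (toℕ i + m) (suc m))

dist : ∀ {n} → Fin n → Fin n → ℕ
dist {suc m} j k = (toℕ k + suc m ∸ toℕ j) % suc m

InOpen : ∀ {n} → Fin n → Fin n → Fin n → Set
InOpen j i k = (0 < dist j k) × (dist j k < dist j i)

inOpen? : ∀ {n} (j i k : Fin n) → Dec (InOpen j i k)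
inOpen? j i k = (0 <? dist j k) ×-dec (dist j k <? dist j i)

-- Configurations of the SSM on W_n (sink 0 not recorded).

Config : ℕ → Set
Config n = Vec ℕ n

b2n : Bool → ℕ
b2n true  = 1
b2n false = 0

Stable : ∀ {n} → Config n → Set
Stable {n} c = (i : Fin n) → lookup c i < 3

-- One stochastic toppling of an unstable vertex i: for each neighbour
-- (counter-clockwise neighbour prev i, clockwise neighbour next i,
-- the sink) a Boolean says whether a grain is sent (positive
-- probability p) or kept (positive probability 1-p).  Every choice has
-- positive probability, so this relation is the support of a toppling.
data Topple {n : ℕ} (c : Config n) : Config n → Set where
  topple : (i : Fin n) → 3 ≤ lookup c i → (sPrev sNext sSink : Bool) →
           Topple c
             (updateAt
               (updateAt
                 (updateAt c i (λ x → x ∸ (b2n sPrev + b2n sNext + b2n sSink)))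
                 (prev i) (λ x → x + b2n sPrev))
               (next i) (λ x → x + b2n sNext))

Stabilises : ∀ {n} → Config n → Config n → Set
Stabilises c c' = Star Topple c c' × Stable c'

-- One step of the Markov chain (with positive probability):
-- add a grain at some vertex i (all μ_i > 0) and stabilise.
ChainStep : ∀ {n} → Config n → Config n → Set
ChainStep {n} c c' = Stable c × Σ (Fin n) (λ i → Stabilises (updateAt c i suc) c')

-- Recurrent state of the (finite) Markov chain on stable configurations:
-- every state reachable from c leads back to c.
Recurrent : ∀ {n} → Config n → Set
Recurrent c = Stable c × (∀ c' → Star ChainStep c c' → Star ChainStep c' c)

level : ∀ {n} → Config n → ℤ
level {n} c = + sum c ℤ.- + n

CyclicallyFirstMaximal : ∀ {n} → Config n → Fin n → Set
CyclicallyFirstMaximal {n} c i =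
  lookup c i ≡ 2 ×
  ∃ (λ (j : Fin n) → lookup c j ≡ 0 × (∀ k → InOpen j i k → lookup c k ≡ 1))

cfm? : ∀ {n} (c : Config n) (i : Fin n) → Dec (CyclicallyFirstMaximal c i)
cfm? c i = (lookup c i ≟ 2) ×-dec
  FinP.any? (λ j → (lookup c j ≟ 0) ×-dec
    FinP.all? (λ k → inOpen? j i k →-dec (lookup c k ≟ 1)))

m : ∀ {n} → Config n → Config n
m c = tabulate λ i →
  if does (lookup c i ≟ 0) then 0 else (if does (cfm? c i) then 2 else 1)

InSome01Chain : ∀ {n} → Config n → Fin n → Set
InSome01Chain {n} c k =
  ∃ λ (j : Fin n) → lookup c j ≡ 0 ×
    (k ≡ j ⊎ (lookup c k ≡ 1 × (∀ k' → InOpen j k k' → lookup c k' ≡ 1)))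

inSome01Chain? : ∀ {n} (c : Config n) (k : Fin n) → Dec (InSome01Chain c k)
inSome01Chain? c k = FinP.any? λ j → (lookup c j ≟ 0) ×-dec
  ((k FinP.≟ j) ⊎-dec ((lookup c k ≟ 1) ×-dec
     FinP.all? (λ k' → inOpen? j k k' →-dec (lookup c k' ≟ 1))))

weight01* : ∀ {n} → Config n → ℕ
weight01* {n} c = count (inSome01Chain? c) (allFin n)

-- Orientations of C_n.  Edge i joins i and next i;
-- lookup O i = true  means it is oriented  i → next i  (clockwise),
-- lookup O i = false means it is oriented  next i → i  (counter-clockwise).

Orientation : ℕ → Set
Orientation n = Vec Bool n

inDeg : ∀ {n} → Orientation n → Fin n → ℕ
inDeg O i = (if lookup O (prev i) then 1 else 0) + (if lookup O i then 0 else 1)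

clockwiseEdges : ∀ {n} → Orientation n → ℕ
clockwiseEdges O = count (λ b → b Data.Bool.≟ true) O

allOrientations : ∀ n → List (Orientation n)
allOrientations zero    = [] List.∷ List.[]
allOrientations (suc n) =
  List.map (true ∷_) (allOrientations n) List.++ List.map (false ∷_) (allOrientations n)

HasInDegrees : ∀ {n} → Config n → Orientation n → Set
HasInDegrees {n} c' O = (i : Fin n) → inDeg O i ≡ lookup c' i

hasInDegrees? : ∀ {n} (c' : Config n) (O : Orientation n) → Dec (HasInDegrees c' O)
hasInDegrees? c' O = FinP.all? (λ i → inDeg O i ≟ lookup c' i)

-- O(c'): counter-clockwise cycle if c' = (1,...,1); otherwise the
-- (unique, for minimal recurrent c') orientation with in-degrees c'
-- (found by exhaustive search; the fallback is never used for
-- minimal recurrent c').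
𝒪 : ∀ {n} → Config n → Orientation n
𝒪 {n} c' with does (VecP.≡-dec _≟_ c' (replicate n 1))
... | true  = replicate n false
... | false with filter (hasInDegrees? c') (allOrientations n)
...   | List.[]     = replicate n false
...   | O List.∷ _  = O

MarkedOrientation : ℕ → Set
MarkedOrientation n = Orientation n × Subset n

ProperlyMarked : ∀ {n} → MarkedOrientation n → Set
ProperlyMarked {n} (O , M) =
  ∃ (λ (e : Fin n) → lookup O e ≡ false) ×
  (∀ (i : Fin n) → i ∈ M → lookup O i ≡ false × lookup O (prev i) ≡ false)

Φ : ∀ {n} → Config n → MarkedOrientation n
Φ c = 𝒪 (m c) , tabulate (λ i → does ((lookup c i ≟ 2) ×-dec ¬? (cfm? c i)))

-- A stable configuration c is recurrent iff it dominates the in-degree sequence of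
-- some orientation of C_n.  Such configurations are closed under the chain, since a
-- grain that a toppling sends to a neighbour pays for turning the shared edge towards
-- that neighbour.  The all-2 configuration is one of them and is reached from every
-- stable configuration by adding grains; conversely every other dominating
-- configuration has a dominating predecessor in the chain, of smaller deficit
-- Σ (2 - c_i) unless it is all-1, so all of them are reached from all-2.
--
-- For such c, let O be the orientation whose clockwise edges (i, i+1) are the vertices
-- i lying in a 01*-chain.  A vertex is cyclically first maximal iff it holds a 2 and
-- its predecessor lies in a 01*-chain, which makes the in-degrees of O equal to m(c);
-- an orientation of a cycle is determined by its in-degrees unless they all equal 1,
-- so O = O(m(c)).  As c = m(c) + 1_M pointwise, Φ_W(c) determines c, the level is |M|
-- (in-degrees sum to n) and weight^{01*}(c) is the number of clockwise edges.
-- Conversely (O, M) is the image of indeg_O + 1_M: from a counter-clockwise edge on,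
-- clockwise edges propagate exactly along 01*-chains.

module Submission where

open import Data.Nat using (ℕ; _≤_)
open import Data.Product using (_×_; ∃)
open import Data.Fin.Subset using (∣_∣)
open import Data.Integer using (+_)
open import Relation.Binary.PropositionalEquality using (_≡_)
open import Data.Product using (proj₁; proj₂)

open import Defs
open import Data.Nat.Base using (zero; suc; _+_; _∸_; _<_; NonZero; z≤n; s≤s; s≤s⁻¹)
open import Data.Nat.Properties
open import Data.Nat.DivMod using (_%_; %-distribˡ-+; m%n%n≡m%n; m<n⇒m%n≡m; [m+n]%n≡m%n; n%n≡0; m%n<n)
open import Data.Integer.Base as ℤ using (_⊖_)
open import Data.Integer.Properties using ([+m]-[+n]≡m⊖n; ⊖-≥)
open import Data.Bool.Base using (Bool; true; false; not; _∧_; _∨_; if_then_else_)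
open import Data.Bool.Properties using () renaming (_≟_ to _≟ᵇ_)
open import Data.Fin.Base using (Fin; toℕ; fromℕ; inject₁; punchIn) renaming (zero to fzero; suc to fsuc)
open import Data.Fin.Properties
  using (any?; punchInᵢ≢i; ¬∀⟶∃¬; toℕ-injective; toℕ-fromℕ<; toℕ<n; toℕ-inject₁; toℕ-fromℕ;
         ≤fromℕ)
  renaming (_≟_ to _≟ᶠ_)
open import Data.Fin.Induction using (<-weakInduction; <-weakInduction-startingFrom)
open import Data.Fin.Permutation using (permutation)
open import Data.Fin.Subset using (Subset) renaming (_∈_ to _∈ₛ_)
open import Data.Vec.Base using (Vec; []; _∷_; lookup; tabulate; replicate; updateAt; _[_]≔_; sum; count)
open import Data.Vec.Properties
  using (lookup-replicate; lookup∘tabulate; lookup∘updateAt; lookup∘updateAt′; lookup∘update; lookup∘update′;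
         ≡-dec; []=⇒lookup; lookup⇒[]=)
open import Data.Vec.Relation.Binary.Pointwise.Extensional using (ext; Pointwise-≡⇒≡)
open import Data.List.Base as List using (filter)
open import Data.List.Membership.Propositional using (_∈_)
open import Data.List.Membership.Propositional.Properties
  using (∈-++⁺ˡ; ∈-++⁺ʳ; ∈-map⁺; ∈-filter⁺; ∈-filter⁻)
open import Data.List.Relation.Unary.Any using (here)
open import Data.Product.Base using (Σ; _,_)
open import Data.Sum.Base using (_⊎_; inj₁; inj₂; [_,_]′)
open import Data.Empty using (⊥-elim)
open import Function.Base using (_∘_; id; case_of_)
open import Function.Bundles using (_⇔_; mk⇔; Equivalence)
open import Level using (Level)
open import Relation.Nullary using (¬_; Dec; yes; no; does; _×-dec_; ¬?)
open import Relation.Nullary.Decidable using (dec-true; dec-false; does-⇔; decidable-stable)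
open import Relation.Nullary.Negation using (contradiction)
open import Relation.Unary using (Pred; Decidable)
open import Relation.Binary.PropositionalEquality
  using (refl; sym; trans; cong; cong₂; subst; subst₂; _≢_; ≢-sym; module ≡-Reasoning)
open import Relation.Binary.Construct.Closure.ReflexiveTransitive using (Star; ε; _◅_; _◅◅_; fold)
open import Algebra.Properties.CommutativeSemigroup +-commutativeSemigroup using (x∙yz≈y∙xz)
open import Algebra.Properties.CommutativeMonoid.Sum +-0-commutativeMonoid
  using (sum-syntax; sum-cong-≗; ∑-distrib-+; sum-remove; sum-permute)

open ≡-Reasoning

private
  variable
    n : ℕ
    ℓ : Level
    A : Set ℓ
    i j k : Fin n

-- Arithmetic on the cycle

[m%o+n]%o≡[m+n]%o : ∀ m n o .{{_ : NonZero o}} → (m % o + n) % o ≡ (m + n) % o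
[m%o+n]%o≡[m+n]%o m n o = begin
  (m % o + n) % o          ≡⟨ %-distribˡ-+ (m % o) n o ⟩
  (m % o % o + n % o) % o  ≡⟨ cong (λ x → (x + n % o) % o) (m%n%n≡m%n m o) ⟩
  (m % o + n % o) % o      ≡⟨ %-distribˡ-+ m n o ⟨
  (m + n) % o              ∎

[m+n%o]%o≡[m+n]%o : ∀ m n o .{{_ : NonZero o}} → (m + n % o) % o ≡ (m + n) % o
[m+n%o]%o≡[m+n]%o m n o = begin
  (m + n % o) % o  ≡⟨ cong (_% o) (+-comm m (n % o)) ⟩
  (n % o + m) % o  ≡⟨ [m%o+n]%o≡[m+n]%o n m o ⟩
  (n + m) % o      ≡⟨ cong (_% o) (+-comm n m) ⟩
  (m + n) % o      ∎

toℕ-next : (i : Fin (suc n)) → toℕ (next i) ≡ suc (toℕ i) % suc n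
toℕ-next i = toℕ-fromℕ< _

toℕ-prev : (i : Fin (suc n)) → toℕ (prev i) ≡ (toℕ i + n) % suc n
toℕ-prev i = toℕ-fromℕ< _

toℕ%n≡toℕ : (i : Fin (suc n)) → toℕ i % suc n ≡ toℕ i
toℕ%n≡toℕ i = m<n⇒m%n≡m (toℕ<n i)

prev-next : (i : Fin (suc n)) → prev (next i) ≡ i
prev-next {n} i = toℕ-injective (begin
  toℕ (prev (next i))                ≡⟨ toℕ-prev (next i) ⟩
  (toℕ (next i) + n) % suc n         ≡⟨ cong (λ x → (x + n) % suc n) (toℕ-next i) ⟩
  (suc (toℕ i) % suc n + n) % suc n  ≡⟨ [m%o+n]%o≡[m+n]%o (suc (toℕ i)) n (suc n) ⟩
  (suc (toℕ i) + n) % suc n          ≡⟨ cong (_% suc n) (+-suc (toℕ i) n) ⟨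
  (toℕ i + suc n) % suc n            ≡⟨ [m+n]%n≡m%n (toℕ i) (suc n) ⟩
  toℕ i % suc n                      ≡⟨ toℕ%n≡toℕ i ⟩
  toℕ i                              ∎)

next-prev : (i : Fin (suc n)) → next (prev i) ≡ i
next-prev {n} i = toℕ-injective (begin
  toℕ (next (prev i))                ≡⟨ toℕ-next (prev i) ⟩
  suc (toℕ (prev i)) % suc n         ≡⟨ cong (λ x → suc x % suc n) (toℕ-prev i) ⟩
  (1 + (toℕ i + n) % suc n) % suc n  ≡⟨ [m+n%o]%o≡[m+n]%o 1 (toℕ i + n) (suc n) ⟩
  suc (toℕ i + n) % suc n            ≡⟨ cong (_% suc n) (+-suc (toℕ i) n) ⟨
  (toℕ i + suc n) % suc n            ≡⟨ [m+n]%n≡m%n (toℕ i) (suc n) ⟩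
  toℕ i % suc n                      ≡⟨ toℕ%n≡toℕ i ⟩
  toℕ i                              ∎)

dist≡ : (j k : Fin (suc n)) → dist j k ≡ (toℕ k + (suc n ∸ toℕ j)) % suc n
dist≡ {n} j k = cong (_% suc n) (+-∸-assoc (toℕ k) (<⇒≤ (toℕ<n j)))

dist<n : (j k : Fin (suc n)) → dist j k < suc n
dist<n {n} j k = m%n<n (toℕ k + suc n ∸ toℕ j) (suc n)

dist-self : (j : Fin (suc n)) → dist j j ≡ 0
dist-self {n} j = begin
  (toℕ j + suc n ∸ toℕ j) % suc n  ≡⟨ cong (_% suc n) (m+n∸m≡n (toℕ j) (suc n)) ⟩
  suc n % suc n                    ≡⟨ n%n≡0 (suc n) ⟩
  0                                ∎

dist-inverse : (j k : Fin (suc n)) → (toℕ j + dist j k) % suc n ≡ toℕ k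
dist-inverse {n} j k = begin
  (toℕ j + dist j k) % suc n                   ≡⟨ cong (λ d → (toℕ j + d) % suc n) (dist≡ j k) ⟩
  (toℕ j + (toℕ k + r) % suc n) % suc n        ≡⟨ [m+n%o]%o≡[m+n]%o (toℕ j) (toℕ k + r) (suc n) ⟩
  (toℕ j + (toℕ k + r)) % suc n                ≡⟨ cong (_% suc n) (x∙yz≈y∙xz (toℕ j) (toℕ k) r) ⟩
  (toℕ k + (toℕ j + r)) % suc n                ≡⟨ cong (λ x → (toℕ k + x) % suc n) (m+[n∸m]≡n j≤n) ⟩
  (toℕ k + suc n) % suc n                      ≡⟨ [m+n]%n≡m%n (toℕ k) (suc n) ⟩
  toℕ k % suc n                                ≡⟨ toℕ%n≡toℕ k ⟩
  toℕ k                                        ∎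
  where
  r = suc n ∸ toℕ j
  j≤n = <⇒≤ (toℕ<n j)

dist-injective : (j : Fin (suc n)) {k k′ : Fin (suc n)} → dist j k ≡ dist j k′ → k ≡ k′
dist-injective {n} j {k} {k′} eq = toℕ-injective (begin
  toℕ k                        ≡⟨ dist-inverse j k ⟨
  (toℕ j + dist j k) % suc n   ≡⟨ cong (λ d → (toℕ j + d) % suc n) eq ⟩
  (toℕ j + dist j k′) % suc n  ≡⟨ dist-inverse j k′ ⟩
  toℕ k′                       ∎)

dist≡0⇒≡ : (j k : Fin (suc n)) → dist j k ≡ 0 → j ≡ k
dist≡0⇒≡ j k eq = dist-injective j (trans (dist-self j) (sym eq))

dist-next : (j k : Fin (suc n)) → dist j (next k) ≡ suc (dist j k) % suc n
dist-next {n} j k = begin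
  dist j (next k)                       ≡⟨ dist≡ j (next k) ⟩
  (toℕ (next k) + r) % suc n            ≡⟨ cong (λ x → (x + r) % suc n) (toℕ-next k) ⟩
  (suc (toℕ k) % suc n + r) % suc n     ≡⟨ [m%o+n]%o≡[m+n]%o (suc (toℕ k)) r (suc n) ⟩
  suc (toℕ k + r) % suc n               ≡⟨ [m+n%o]%o≡[m+n]%o 1 (toℕ k + r) (suc n) ⟨
  suc ((toℕ k + r) % suc n) % suc n     ≡⟨ cong (λ d → suc d % suc n) (dist≡ j k) ⟨
  suc (dist j k) % suc n                ∎
  where r = suc n ∸ toℕ j

dist-prev : (j k : Fin (suc n)) → k ≢ j → dist j k ≡ suc (dist j (prev k))
dist-prev {n} j k k≢j =
  [ (λ 1+d<n → trans via-next (m<n⇒m%n≡m 1+d<n))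
  , (λ 1+d≡n → contradiction (dist≡0⇒≡ j k (trans via-next (trans (cong (_% suc n) 1+d≡n) (n%n≡0 (suc n)))))
                               (≢-sym k≢j))
  ]′ (m≤n⇒m<n∨m≡n (dist<n j (prev k)))
  where
  via-next : dist j k ≡ suc (dist j (prev k)) % suc n
  via-next = trans (cong (dist j) (sym (next-prev k))) (dist-next j (prev k))

next≢ : (i : Fin (2 + n)) → next i ≢ i
next≢ {n} i eq = 1+n≢0 (begin
  1                         ≡⟨ cong (λ d → suc d % (2 + n)) (dist-self i) ⟨
  suc (dist i i) % (2 + n)  ≡⟨ dist-next i i ⟨
  dist i (next i)           ≡⟨ cong (dist i) eq ⟩
  dist i i                  ≡⟨ dist-self i ⟩
  0                         ∎)

next²≢ : (i : Fin (3 + n)) → next (next i) ≢ i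
next²≢ {n} i eq = 1+n≢0 (begin
  2                                         ≡⟨ cong (λ d → suc (suc d % (3 + n)) % (3 + n)) (dist-self i) ⟨
  suc (suc (dist i i) % (3 + n)) % (3 + n)  ≡⟨ cong (λ d → suc d % (3 + n)) (dist-next i i) ⟨
  suc (dist i (next i)) % (3 + n)           ≡⟨ dist-next i (next i) ⟨
  dist i (next (next i))                    ≡⟨ cong (dist i) eq ⟩
  dist i i                                  ≡⟨ dist-self i ⟩
  0                                         ∎)

prev≢ : (i : Fin (2 + n)) → prev i ≢ i
prev≢ i eq = next≢ i (trans (cong next (sym eq)) (next-prev i))

prev≢next : (i : Fin (3 + n)) → prev i ≢ next i
prev≢next i eq = next²≢ i (trans (cong next (sym eq)) (next-prev i))

prev²≢ : (i : Fin (3 + n)) → prev (prev i) ≢ i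
prev²≢ i eq = next²≢ i (begin
  next (next i)                ≡⟨ cong (next ∘ next) eq ⟨
  next (next (prev (prev i)))  ≡⟨ cong next (next-prev (prev i)) ⟩
  next (prev i)                ≡⟨ next-prev i ⟩
  i                            ∎)

next-inject₁ : (i : Fin n) → next (inject₁ i) ≡ fsuc i
next-inject₁ {n} i = toℕ-injective (begin
  toℕ (next (inject₁ i))         ≡⟨ toℕ-next (inject₁ i) ⟩
  suc (toℕ (inject₁ i)) % suc n  ≡⟨ cong (λ x → suc x % suc n) (toℕ-inject₁ i) ⟩
  suc (toℕ i) % suc n            ≡⟨ m<n⇒m%n≡m (s≤s (toℕ<n i)) ⟩
  suc (toℕ i)                    ∎)

next-fromℕ : next (fromℕ n) ≡ fzero
next-fromℕ {n} = toℕ-injective (begin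
  toℕ (next (fromℕ n))         ≡⟨ toℕ-next (fromℕ n) ⟩
  suc (toℕ (fromℕ n)) % suc n  ≡⟨ cong (λ x → suc x % suc n) (toℕ-fromℕ n) ⟩
  suc n % suc n                ≡⟨ n%n≡0 (suc n) ⟩
  0                            ∎)

cycle-induction : (P : Fin (suc n) → Set ℓ) → (∀ i → P i → P (next i)) → ∀ {i} → P i → ∀ j → P j
cycle-induction P step {i} Pi = <-weakInduction P P₀ step′
  where
  step′ : ∀ j → P (inject₁ j) → P (fsuc j)
  step′ j = subst P (next-inject₁ j) ∘ step (inject₁ j)
  P₀ : P fzero
  P₀ = subst P next-fromℕ (step _ (<-weakInduction-startingFrom P Pi step′ (≤fromℕ i)))

-- Open intervals and 01*-chains

dist-prev< : {j i : Fin (suc n)} → j ≢ i → dist j (prev i) < dist j i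
dist-prev< {j = j} {i} j≢i = subst (dist j (prev i) <_) (sym (dist-prev j i (≢-sym j≢i))) (n<1+n _)

InOpen-prev⁻ : {j i k : Fin (suc n)} → j ≢ i → InOpen j i k → k ≡ prev i ⊎ InOpen j (prev i) k
InOpen-prev⁻ {j = j} {i} {k} j≢i (0<d , d<dist)
  with m≤n⇒m<n∨m≡n (s≤s⁻¹ (subst (dist j k <_) (dist-prev j i (≢-sym j≢i)) d<dist))
... | inj₁ d<dist′ = inj₂ (0<d , d<dist′)
... | inj₂ d≡dist′ = inj₁ (dist-injective j d≡dist′)

InOpen-prev⁺ : {j i k : Fin (suc n)} → j ≢ i → InOpen j (prev i) k → InOpen j i k
InOpen-prev⁺ j≢i (0<d , d<dist′) = 0<d , <-trans d<dist′ (dist-prev< j≢i)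

InOpen-last : {j i : Fin (suc n)} → j ≢ i → prev i ≢ j → InOpen j i (prev i)
InOpen-last {j = j} {i} j≢i prev-i≢j = n≢0⇒n>0 (prev-i≢j ∘ sym ∘ dist≡0⇒≡ j (prev i)) , dist-prev< j≢i

InOpen-empty : {j i k : Fin (suc n)} → prev i ≡ j → ¬ InOpen j i k
InOpen-empty {j = j} {i} {k} prev-i≡j (0<d , d<dist) with i ≟ᶠ j
... | yes refl = n≮0 (subst (dist j k <_) (dist-self j) d<dist)
... | no i≢j   = <⇒≱ d<dist (subst (_≤ dist j k) (sym dist≡1) 0<d)
  where
  dist≡1 : dist j i ≡ 1
  dist≡1 = begin
    dist j i               ≡⟨ dist-prev j i i≢j ⟩
    suc (dist j (prev i))  ≡⟨ cong (suc ∘ dist j) prev-i≡j ⟩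
    suc (dist j j)         ≡⟨ cong suc (dist-self j) ⟩
    1                      ∎

AllInOpen : (Fin n → Set ℓ) → Fin n → Fin n → Set ℓ
AllInOpen P j i = ∀ k → InOpen j i k → P k

AllInOpen-unfold : {P : Fin (suc n) → Set ℓ} {j i : Fin (suc n)} → j ≢ i → AllInOpen P j i →
                   prev i ≡ j ⊎ (P (prev i) × AllInOpen P j (prev i))
AllInOpen-unfold {j = j} {i} j≢i all with prev i ≟ᶠ j
... | yes prev-i≡j = inj₁ prev-i≡j
... | no prev-i≢j  = inj₂ (all (prev i) (InOpen-last j≢i prev-i≢j) , λ k → all k ∘ InOpen-prev⁺ j≢i)

AllInOpen-fold : {P : Fin (suc n) → Set ℓ} {j i : Fin (suc n)} → j ≢ i →
                 prev i ≡ j ⊎ (P (prev i) × AllInOpen P j (prev i)) → AllInOpen P j i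
AllInOpen-fold j≢i (inj₁ prev-i≡j) k k∈ = ⊥-elim (InOpen-empty prev-i≡j k∈)
AllInOpen-fold j≢i (inj₂ (P-prev-i , all)) k k∈ with InOpen-prev⁻ j≢i k∈
... | inj₁ refl = P-prev-i
... | inj₂ k∈′  = all k k∈′

≢-by-values : (c : Config n) {x y : ℕ} → lookup c j ≡ x → lookup c k ≡ y → x ≢ y → j ≢ k
≢-by-values _ cj≡x ck≡y x≢y refl = x≢y (trans (sym cj≡x) ck≡y)

lookup≢ : (c : Config n) {x y : ℕ} → lookup c i ≡ x → x ≢ y → lookup c i ≢ y
lookup≢ _ ci≡x x≢y ci≡y = x≢y (trans (sym ci≡x) ci≡y)

InSome01Chain-zero : (c : Config n) → lookup c k ≡ 0 → InSome01Chain c k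
InSome01Chain-zero {k = k} c ck≡0 = k , ck≡0 , inj₁ refl

InSome01Chain-step : (c : Config (suc n)) → lookup c k ≡ 1 → InSome01Chain c (prev k) → InSome01Chain c k
InSome01Chain-step c ck≡1 (j , cj≡0 , chain) =
  j , cj≡0 , inj₂ (ck≡1 , AllInOpen-fold (≢-by-values c cj≡0 ck≡1 λ ()) chain)

InSome01Chain-unfold : (c : Config (suc n)) → InSome01Chain c k →
                       lookup c k ≡ 0 ⊎ (lookup c k ≡ 1 × InSome01Chain c (prev k))
InSome01Chain-unfold c (j , cj≡0 , inj₁ refl)          = inj₁ cj≡0
InSome01Chain-unfold c (j , cj≡0 , inj₂ (ck≡1 , ones)) =
  inj₂ (ck≡1 , j , cj≡0 , AllInOpen-unfold (≢-by-values c cj≡0 ck≡1 λ ()) ones)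

two∉01Chain : (c : Config (suc n)) → lookup c i ≡ 2 → ¬ InSome01Chain c i
two∉01Chain c ci≡2 chain with InSome01Chain-unfold c chain
... | inj₁ ci≡0       = lookup≢ c ci≡2 (λ ()) ci≡0
... | inj₂ (ci≡1 , _) = lookup≢ c ci≡2 (λ ()) ci≡1

CyclicallyFirstMaximal⇔01Chain : (c : Config (suc n)) → lookup c i ≡ 2 →
                                 CyclicallyFirstMaximal c i ⇔ InSome01Chain c (prev i)
CyclicallyFirstMaximal⇔01Chain c ci≡2 = mk⇔
  (λ (_ , j , cj≡0 , ones) → j , cj≡0 , AllInOpen-unfold (≢-by-values c cj≡0 ci≡2 λ ()) ones)
  (λ (j , cj≡0 , chain)    → ci≡2 , j , cj≡0 , AllInOpen-fold (≢-by-values c cj≡0 ci≡2 λ ()) chain)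

lookup-ext : {u v : Vec A n} → (∀ i → lookup u i ≡ lookup v i) → u ≡ v
lookup-ext = Pointwise-≡⇒≡ ∘ ext

sum≡∑lookup : (v : Vec ℕ n) → sum v ≡ ∑[ i < n ] lookup v i
sum≡∑lookup []      = refl
sum≡∑lookup (x ∷ v) = cong (λ s → x + s) (sum≡∑lookup v)

∣∣≡∑b2n : (M : Subset n) → ∣ M ∣ ≡ ∑[ i < n ] b2n (lookup M i)
∣∣≡∑b2n []          = refl
∣∣≡∑b2n (true ∷ M)  = cong suc (∣∣≡∑b2n M)
∣∣≡∑b2n (false ∷ M) = ∣∣≡∑b2n M

∑-const-1 : ∀ n → ∑[ i < n ] 1 ≡ n
∑-const-1 zero    = refl
∑-const-1 (suc n) = cong suc (∑-const-1 n)

∑-prev : (f : Fin (suc n) → ℕ) → ∑[ i < suc n ] f (prev i) ≡ ∑[ i < suc n ] f i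
∑-prev f = sym (sum-permute f (permutation prev next prev-next next-prev))

∑-update : (f g : Fin (suc n) → ℕ) (j : Fin (suc n)) → (∀ k → k ≢ j → f k ≡ g k) →
           f j + ∑[ i < suc n ] g i ≡ g j + ∑[ i < suc n ] f i
∑-update {n} f g j f≡g = begin
  f j + ∑[ i < suc n ] g i                  ≡⟨ cong (λ s → f j + s) (sum-remove {i = j} g) ⟩
  f j + (g j + ∑[ i < n ] g (punchIn j i))  ≡⟨ x∙yz≈y∙xz (f j) (g j) _ ⟩
  g j + (f j + ∑[ i < n ] g (punchIn j i))  ≡⟨ cong (λ s → g j + (f j + s)) (sum-cong-≗ g≗f) ⟩
  g j + (f j + ∑[ i < n ] f (punchIn j i))  ≡⟨ cong (λ s → g j + s) (sum-remove {i = j} f) ⟨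
  g j + ∑[ i < suc n ] f i                  ∎
  where
  g≗f : ∀ i → g (punchIn j i) ≡ f (punchIn j i)
  g≗f i = sym (f≡g (punchIn j i) (punchInᵢ≢i j i))

count≡count-does : {P : Pred A ℓ} (P? : Decidable P) (f : Fin n → A) →
                   count P? (tabulate f) ≡ count (_≟ᵇ true) (tabulate (does ∘ P? ∘ f))
count≡count-does {n = zero}  P? f = refl
count≡count-does {n = suc n} P? f with does (P? (f fzero))
... | true  = cong suc (count≡count-does P? (f ∘ fsuc))
... | false = count≡count-does P? (f ∘ fsuc)

b2n≤1 : ∀ b → b2n b ≤ 1
b2n≤1 true  = ≤-refl
b2n≤1 false = z≤n

b2n-injective : ∀ {x y} → b2n x ≡ b2n y → x ≡ y
b2n-injective {true}  {true}  _ = refl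
b2n-injective {false} {false} _ = refl

does∧not-does : {A B : Set} (a? : Dec A) (b? : Dec B) → does a? ∧ not (does b?) ≡ true → A × ¬ B
does∧not-does (yes a) (no ¬b) _ = a , ¬b

-- In-degrees of orientations of the cycle

in-edges : (left right : Bool) → ℕ
in-edges l r = b2n l + b2n (not r)

in-edges-same : ∀ b → in-edges b b ≡ 1
in-edges-same true  = refl
in-edges-same false = refl

inDeg≡ : (O : Orientation (suc n)) (i : Fin (suc n)) → inDeg O i ≡ in-edges (lookup O (prev i)) (lookup O i)
inDeg≡ O i = cong₂ _+_ (if-then-1-else-0 (lookup O (prev i))) (if-then-0-else-1 (lookup O i))
  where
  if-then-1-else-0 : ∀ b → (if b then 1 else 0) ≡ b2n b
  if-then-1-else-0 true  = refl
  if-then-1-else-0 false = refl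
  if-then-0-else-1 : ∀ b → (if b then 0 else 1) ≡ b2n (not b)
  if-then-0-else-1 true  = refl
  if-then-0-else-1 false = refl

inDeg-next : (O : Orientation (suc n)) (i : Fin (suc n)) →
             inDeg O (next i) ≡ in-edges (lookup O i) (lookup O (next i))
inDeg-next O i = trans (inDeg≡ O (next i)) (cong (λ j → in-edges (lookup O j) (lookup O (next i))) (prev-next i))

inDeg≤2 : (O : Orientation (suc n)) (i : Fin (suc n)) → inDeg O i ≤ 2
inDeg≤2 O i = subst (_≤ 2) (sym (inDeg≡ O i)) (+-mono-≤ (b2n≤1 (lookup O (prev i))) (b2n≤1 (not (lookup O i))))

∑-inDeg : (O : Orientation (suc n)) → ∑[ i < suc n ] inDeg O i ≡ suc n
∑-inDeg {n} O = begin
  ∑[ i < suc n ] inDeg O i                                  ≡⟨ sum-cong-≗ (inDeg≡ O) ⟩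
  ∑[ i < suc n ] in-edges (lookup O (prev i)) (lookup O i)  ≡⟨ ∑-distrib-+ (b2n ∘ lookup O ∘ prev) b2n-not ⟩
  ∑[ i < suc n ] b2n (lookup O (prev i)) + ∑[ i < suc n ] b2n-not i
                                                            ≡⟨ cong (_+ ∑[ i < suc n ] b2n-not i) (∑-prev (b2n ∘ lookup O)) ⟩
  ∑[ i < suc n ] b2n (lookup O i) + ∑[ i < suc n ] b2n-not i
                                                            ≡⟨ ∑-distrib-+ (b2n ∘ lookup O) b2n-not ⟨
  ∑[ i < suc n ] in-edges (lookup O i) (lookup O i)         ≡⟨ sum-cong-≗ (in-edges-same ∘ lookup O) ⟩
  ∑[ i < suc n ] 1                                          ≡⟨ ∑-const-1 (suc n) ⟩
  suc n                                                     ∎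
  where
  b2n-not : Fin (suc n) → ℕ
  b2n-not i = b2n (not (lookup O i))

inDeg-ccw : (k : Fin (suc n)) → inDeg (replicate (suc n) false) k ≡ 1
inDeg-ccw {n} k = trans (inDeg≡ (replicate (suc n) false) k)
  (cong₂ in-edges (lookup-replicate (prev k) false) (lookup-replicate k false))

inDeg-cong : (O O′ : Orientation n) (k : Fin n) →
             lookup O (prev k) ≡ lookup O′ (prev k) → lookup O k ≡ lookup O′ k → inDeg O k ≡ inDeg O′ k
inDeg-cong O O′ k = cong₂ (λ a b → (if a then 1 else 0) + (if b then 0 else 1))

inDeg-update : (O : Orientation (suc n)) (j : Fin (suc n)) (x : Bool) (k : Fin (suc n)) →
               k ≢ j → k ≢ next j → inDeg (O [ j ]≔ x) k ≡ inDeg O k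
inDeg-update O j x k k≢j k≢next = inDeg-cong (O [ j ]≔ x) O k
  (lookup∘update′ (λ prev-k≡j → k≢next (trans (sym (next-prev k)) (cong next prev-k≡j))) O x)
  (lookup∘update′ k≢j O x)

reversal-next : (O O′ : Orientation (suc n)) → (∀ i → inDeg O i ≡ inDeg O′ i) →
                ∀ i → lookup O i ≡ true × lookup O′ i ≡ false →
                lookup O (next i) ≡ true × lookup O′ (next i) ≡ false
reversal-next O O′ same i (Oi , O′i) = reversal (lookup O (next i)) (lookup O′ (next i)) (begin
  suc (b2n (not (lookup O (next i))))          ≡⟨ cong (λ b → in-edges b (lookup O (next i))) Oi ⟨
  in-edges (lookup O i) (lookup O (next i))    ≡⟨ inDeg-next O i ⟨
  inDeg O (next i)                             ≡⟨ same (next i) ⟩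
  inDeg O′ (next i)                            ≡⟨ inDeg-next O′ i ⟩
  in-edges (lookup O′ i) (lookup O′ (next i))  ≡⟨ cong (λ b → in-edges b (lookup O′ (next i))) O′i ⟩
  b2n (not (lookup O′ (next i)))               ∎)
  where
  reversal : ∀ x y → suc (b2n (not x)) ≡ b2n (not y) → x ≡ true × y ≡ false
  reversal true  false _  = refl , refl
  reversal true  true  ()
  reversal false true  ()
  reversal false false ()

same-inDeg-differ⇒inDeg≡1 : (O O′ : Orientation (suc n)) → (∀ i → inDeg O i ≡ inDeg O′ i) →
                            ∀ {x} → lookup O x ≡ true → lookup O′ x ≡ false → ∀ i → inDeg O i ≡ 1
same-inDeg-differ⇒inDeg≡1 O O′ same Ox O′x i =
  trans (inDeg≡ O i) (cong₂ in-edges (clockwise (prev i)) (clockwise i))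
  where
  clockwise : ∀ j → lookup O j ≡ true
  clockwise = proj₁ ∘ cycle-induction (λ y → lookup O y ≡ true × lookup O′ y ≡ false)
                                      (reversal-next O O′ same) (Ox , O′x)

inDeg-injective : {O O′ : Orientation (suc n)} → (∀ i → inDeg O i ≡ inDeg O′ i) →
                  (∃ λ i → inDeg O i ≢ 1) → O ≡ O′
inDeg-injective {O = O} {O′} same (i , inDeg≢1) = lookup-ext agree
  where
  agree : ∀ x → lookup O x ≡ lookup O′ x
  agree x with lookup O x in Ox | lookup O′ x in O′x
  ... | true  | true  = refl
  ... | false | false = refl
  ... | true  | false = ⊥-elim (inDeg≢1 (same-inDeg-differ⇒inDeg≡1 O O′ same Ox O′x i))
  ... | false | true  = ⊥-elim (inDeg≢1 (trans (same i) (same-inDeg-differ⇒inDeg≡1 O′ O (sym ∘ same) O′x Ox i)))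

allOrientations-complete : (O : Orientation n) → O ∈ allOrientations n
allOrientations-complete []          = here refl
allOrientations-complete (true ∷ O)  = ∈-++⁺ˡ (∈-map⁺ (true ∷_) (allOrientations-complete O))
allOrientations-complete (false ∷ O) =
  ∈-++⁺ʳ (List.map (true ∷_) (allOrientations _)) (∈-map⁺ (false ∷_) (allOrientations-complete O))

𝒪-unique : (c′ : Config (suc n)) (O : Orientation (suc n)) → HasInDegrees c′ O →
           (c′ ≡ replicate (suc n) 1 → O ≡ replicate (suc n) false) → 𝒪 c′ ≡ O
𝒪-unique {n} c′ O hasO ones with ≡-dec _≟_ c′ (replicate (suc n) 1)
... | yes c′≡1 = sym (ones c′≡1)
... | no c′≢1 with filter (hasInDegrees? c′) (allOrientations (suc n)) in eq
...   | List.[]     = contradiction (subst (O ∈_) eq O∈filter) λ ()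
  where
  O∈filter = ∈-filter⁺ (hasInDegrees? c′) (allOrientations-complete O) hasO
...   | O′ List.∷ _ = inDeg-injective (λ i → trans (hasO′ i) (sym (hasO i))) non-1-inDeg
  where
  hasO′ : HasInDegrees c′ O′
  hasO′ = proj₂ (∈-filter⁻ (hasInDegrees? c′) {xs = allOrientations (suc n)} (subst (O′ ∈_) (sym eq) (here refl)))
  non-1-inDeg : ∃ λ i → inDeg O′ i ≢ 1
  non-1-inDeg with ¬∀⟶∃¬ (suc n) _ (λ i → lookup c′ i ≟ 1)
                      (λ all-1 → c′≢1 (lookup-ext λ i → trans (all-1 i) (sym (lookup-replicate i 1))))
  ... | x , c′ₓ≢1 = x , c′ₓ≢1 ∘ trans (sym (hasO′ x))

-- Configurations dominating an orientation

record Dominates (c : Config n) (O : Orientation n) : Set where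
  constructor dominates
  field inDeg≤ : ∀ i → inDeg O i ≤ lookup c i

open Dominates public

Dominates-mono : {c c′ : Config n} {O : Orientation n} →
                 (∀ k → lookup c k ≤ lookup c′ k) → Dominates c O → Dominates c′ O
Dominates-mono c≤c′ dom = dominates λ k → ≤-trans (inDeg≤ dom k) (c≤c′ k)

module _ {c : Config (suc n)} {O : Orientation (suc n)} (dom : Dominates c O) where

  zero-orientation : lookup c i ≡ 0 → lookup O (prev i) ≡ false × lookup O i ≡ true
  zero-orientation {i} ci≡0 =
    no-in-edge (lookup O (prev i)) (lookup O i) (subst₂ _≤_ (inDeg≡ O i) ci≡0 (inDeg≤ dom i))
    where
    no-in-edge : ∀ a b → in-edges a b ≤ 0 → a ≡ false × b ≡ true
    no-in-edge false true _ = refl , refl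

  zero⇒next-in-degree : lookup c j ≡ 0 → suc (b2n (not (lookup O (next j)))) ≤ lookup c (next j)
  zero⇒next-in-degree {j} cj≡0 = subst (_≤ lookup c (next j))
    (trans (inDeg-next O j) (cong (λ a → in-edges a (lookup O (next j))) (proj₂ (zero-orientation cj≡0))))
    (inDeg≤ dom (next j))

  clockwise-next : lookup c (next i) ≤ 1 → lookup O i ≡ true → lookup O (next i) ≡ true
  clockwise-next {i} c≤1 Oi≡true =
    one-in-edge (lookup O (next i)) (≤-trans (subst (_≤ lookup c (next i)) in-degree (inDeg≤ dom (next i))) c≤1)
    where
    in-degree : inDeg O (next i) ≡ suc (b2n (not (lookup O (next i))))
    in-degree = trans (inDeg-next O i) (cong (λ b → in-edges b (lookup O (next i))) Oi≡true)
    one-in-edge : ∀ b → suc (b2n (not b)) ≤ 1 → b ≡ true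
    one-in-edge true  _ = refl
    one-in-edge false (s≤s ())

  InSome01Chain⇒clockwise : InSome01Chain c k → lookup O k ≡ true
  InSome01Chain⇒clockwise {k} chain@(j , cj≡0 , _) =
    cycle-induction (λ x → InSome01Chain c x → lookup O x ≡ true) step {j}
                    (λ _ → proj₂ (zero-orientation cj≡0)) k chain
    where
    step : ∀ x → (InSome01Chain c x → lookup O x ≡ true) →
           InSome01Chain c (next x) → lookup O (next x) ≡ true
    step x hyp chain-next with InSome01Chain-unfold c chain-next
    ... | inj₁ c≡0                = proj₂ (zero-orientation c≡0)
    ... | inj₂ (c≡1 , chain-prev) =
      clockwise-next (≤-reflexive c≡1) (hyp (subst (InSome01Chain c) (prev-next x) chain-prev))

  zero⇒prev∉01Chain : lookup c i ≡ 0 → ¬ InSome01Chain c (prev i)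
  zero⇒prev∉01Chain ci≡0 chain =
    contradiction (trans (sym (InSome01Chain⇒clockwise chain)) (proj₁ (zero-orientation ci≡0))) λ ()

  ≤1⇒no-zero : (∀ k → lookup c k ≤ 1) → ∀ z → lookup c z ≢ 0
  ≤1⇒no-zero ≤1 z cz≡0 = contradiction (trans (sym all-clockwise) (proj₁ (zero-orientation cz≡0))) λ ()
    where
    all-clockwise : lookup O (prev z) ≡ true
    all-clockwise = cycle-induction (λ x → lookup O x ≡ true) (λ x → clockwise-next (≤1 (next x)))
                      (proj₂ (zero-orientation cz≡0)) (prev z)

-- The map Φ_W

chainOrientation : Config n → Orientation n
chainOrientation c = tabulate (λ i → does (inSome01Chain? c i))

chainOrientation-true : (c : Config n) (i : Fin n) → InSome01Chain c i → lookup (chainOrientation c) i ≡ true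
chainOrientation-true c i chain = trans (lookup∘tabulate _ i) (dec-true (inSome01Chain? c i) chain)

chainOrientation-false : (c : Config n) (i : Fin n) → ¬ InSome01Chain c i → lookup (chainOrientation c) i ≡ false
chainOrientation-false c i ¬chain = trans (lookup∘tabulate _ i) (dec-false (inSome01Chain? c i) ¬chain)

marks : Config n → Subset n
marks c = proj₂ (Φ c)

m-zero : (c : Config n) → lookup c i ≡ 0 → lookup (m c) i ≡ 0
m-zero {i = i} c ci≡0 = trans (lookup∘tabulate _ i)
  (cong (λ b → if b then 0 else (if does (cfm? c i) then 2 else 1)) (dec-true (lookup c i ≟ 0) ci≡0))

m-nonzero : (c : Config n) → lookup c i ≢ 0 → lookup (m c) i ≡ (if does (cfm? c i) then 2 else 1)
m-nonzero {i = i} c ci≢0 = trans (lookup∘tabulate _ i)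
  (cong (λ b → if b then 0 else (if does (cfm? c i) then 2 else 1)) (dec-false (lookup c i ≟ 0) ci≢0))

m-one : (c : Config n) → lookup c i ≡ 1 → lookup (m c) i ≡ 1
m-one {i = i} c ci≡1 = trans (m-nonzero c (lookup≢ c ci≡1 λ ()))
  (cong (λ b → if b then 2 else 1) (dec-false (cfm? c i) (lookup≢ c ci≡1 (λ ()) ∘ proj₁)))

lookup-marks : (c : Config n) (i : Fin n) → lookup (marks c) i ≡ does (lookup c i ≟ 2) ∧ not (does (cfm? c i))
lookup-marks c i = lookup∘tabulate _ i

marks-≢2 : (c : Config n) → lookup c i ≢ 2 → lookup (marks c) i ≡ false
marks-≢2 {i = i} c ci≢2 =
  trans (lookup-marks c i) (cong (_∧ not (does (cfm? c i))) (dec-false (lookup c i ≟ 2) ci≢2))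

marks-2 : (c : Config n) → lookup c i ≡ 2 → lookup (marks c) i ≡ not (does (cfm? c i))
marks-2 {i = i} c ci≡2 =
  trans (lookup-marks c i) (cong (_∧ not (does (cfm? c i))) (dec-true (lookup c i ≟ 2) ci≡2))

marked⇒ : (c : Config n) → lookup (marks c) i ≡ true → lookup c i ≡ 2 × ¬ CyclicallyFirstMaximal c i
marked⇒ {i = i} c marked = does∧not-does (lookup c i ≟ 2) (cfm? c i) (trans (sym (lookup-marks c i)) marked)

lookup≡m+marks : (c : Config n) → Stable c → ∀ i → lookup c i ≡ lookup (m c) i + b2n (lookup (marks c) i)
lookup≡m+marks c stable i with lookup c i in ci | stable i
... | 0 | _ = sym (cong₂ _+_ (m-zero c ci) (cong b2n (marks-≢2 c (lookup≢ c ci λ ()))))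
... | 1 | _ = sym (cong₂ _+_ (m-one c ci) (cong b2n (marks-≢2 c (lookup≢ c ci λ ()))))
... | 2 | _ = sym (trans (cong₂ (λ x b → x + b2n b) (m-nonzero c (lookup≢ c ci λ ())) (marks-2 c ci))
                         (split (does (cfm? c i))))
  where
  split : ∀ b → (if b then 2 else 1) + b2n (not b) ≡ 2
  split true  = refl
  split false = refl
... | suc (suc (suc _)) | s≤s (s≤s (s≤s ()))

inDeg-chainOrientation≡ : (c : Config (suc n)) (i : Fin (suc n)) →
                          inDeg (chainOrientation c) i ≡
                            in-edges (does (inSome01Chain? c (prev i))) (does (inSome01Chain? c i))
inDeg-chainOrientation≡ c i = trans (inDeg≡ (chainOrientation c) i)
  (cong₂ in-edges (lookup∘tabulate (λ i → does (inSome01Chain? c i)) (prev i))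
                  (lookup∘tabulate (λ i → does (inSome01Chain? c i)) i))

inDeg-chainOrientation : {c : Config (suc n)} {O : Orientation (suc n)} → Stable c → Dominates c O →
                         ∀ i → inDeg (chainOrientation c) i ≡ lookup (m c) i
inDeg-chainOrientation {c = c} stable dom i with lookup c i in ci | stable i
... | 0 | _ = trans (inDeg-chainOrientation≡ c i) (trans
  (cong₂ in-edges (dec-false (inSome01Chain? c (prev i)) (zero⇒prev∉01Chain dom ci))
                  (dec-true (inSome01Chain? c i) (InSome01Chain-zero c ci)))
  (sym (m-zero c ci)))
... | 1 | _ = trans (inDeg-chainOrientation≡ c i) (trans
  (cong (in-edges (does (inSome01Chain? c (prev i))))
        (does-⇔ chain⇔prev-chain (inSome01Chain? c i) (inSome01Chain? c (prev i))))
  (trans (in-edges-same (does (inSome01Chain? c (prev i)))) (sym (m-one c ci))))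
  where
  chain⇔prev-chain : InSome01Chain c i ⇔ InSome01Chain c (prev i)
  chain⇔prev-chain = mk⇔ (λ chain → case InSome01Chain-unfold c chain of λ where
                            (inj₁ ci≡0)         → contradiction ci≡0 (lookup≢ c ci λ ())
                            (inj₂ (_ , chain′)) → chain′)
                         (InSome01Chain-step c ci)
... | 2 | _ = trans (inDeg-chainOrientation≡ c i) (trans
  (cong₂ in-edges (sym (does-⇔ (CyclicallyFirstMaximal⇔01Chain c ci) (cfm? c i) (inSome01Chain? c (prev i))))
                  (dec-false (inSome01Chain? c i) (two∉01Chain c ci)))
  (trans (split (does (cfm? c i))) (sym (m-nonzero c (lookup≢ c ci λ ())))))
  where
  split : ∀ b → b2n b + 1 ≡ (if b then 2 else 1)
  split true  = refl
  split false = refl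
... | suc (suc (suc _)) | s≤s (s≤s (s≤s ()))

lookup≡inDeg+marks : {c : Config (suc n)} {O : Orientation (suc n)} → Stable c → Dominates c O →
                     ∀ i → lookup c i ≡ inDeg (chainOrientation c) i + b2n (lookup (marks c) i)
lookup≡inDeg+marks {c = c} stable dom i =
  trans (lookup≡m+marks c stable i) (cong (_+ b2n (lookup (marks c) i)) (sym (inDeg-chainOrientation stable dom i)))

𝒪∘m≡chainOrientation : {c : Config (suc n)} {O : Orientation (suc n)} → Stable c → Dominates c O →
                       𝒪 (m c) ≡ chainOrientation c
𝒪∘m≡chainOrientation {n} {c} stable dom =
  𝒪-unique (m c) (chainOrientation c) (inDeg-chainOrientation stable dom) chainless
  where
  chainless : m c ≡ replicate (suc n) 1 → chainOrientation c ≡ replicate (suc n) false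
  chainless m≡1 = lookup-ext λ i → trans (chainOrientation-false c i no-chain) (sym (lookup-replicate i false))
    where
    no-chain : ∀ {i} → ¬ InSome01Chain c i
    no-chain (j , cj≡0 , _) =
      0≢1+n (trans (sym (m-zero c cj≡0)) (trans (cong (λ v → lookup v j) m≡1) (lookup-replicate j 1)))

Φ-reconstruct : {c : Config (suc n)} {O : Orientation (suc n)} → Stable c → Dominates c O →
                ∀ i → lookup c i ≡ inDeg (proj₁ (Φ c)) i + b2n (lookup (proj₂ (Φ c)) i)
Φ-reconstruct {c = c} stable dom i = trans (lookup≡inDeg+marks stable dom i)
  (cong (λ O′ → inDeg O′ i + b2n (lookup (marks c) i)) (sym (𝒪∘m≡chainOrientation stable dom)))

Φ-injective : {c d : Config (suc n)} {O O′ : Orientation (suc n)} →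
              Stable c → Dominates c O → Stable d → Dominates d O′ → Φ c ≡ Φ d → c ≡ d
Φ-injective stable-c dom-c stable-d dom-d Φc≡Φd = lookup-ext λ i →
  trans (Φ-reconstruct stable-c dom-c i)
    (trans (cong (λ φ → inDeg (proj₁ φ) i + b2n (lookup (proj₂ φ) i)) Φc≡Φd)
           (sym (Φ-reconstruct stable-d dom-d i)))

Φ-properlyMarked : {c : Config (suc n)} {O : Orientation (suc n)} → Stable c → Dominates c O →
                   ProperlyMarked (Φ c)
Φ-properlyMarked {c = c} stable dom = subst (λ O′ → ProperlyMarked (O′ , marks c))
  (sym (𝒪∘m≡chainOrientation stable dom)) (counter-clockwise-edge , marked-edges)
  where
  counter-clockwise-edge : ∃ λ e → lookup (chainOrientation c) e ≡ false
  counter-clockwise-edge with any? (λ i → lookup c i ≟ 0)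
  ... | yes (z , cz≡0) = prev z , chainOrientation-false c (prev z) (zero⇒prev∉01Chain dom cz≡0)
  ... | no no-zero     = fzero , chainOrientation-false c fzero λ (j , cj≡0 , _) → no-zero (j , cj≡0)
  marked-edges : ∀ i → i ∈ₛ marks c →
                 lookup (chainOrientation c) i ≡ false × lookup (chainOrientation c) (prev i) ≡ false
  marked-edges i i∈M with marked⇒ c ([]=⇒lookup i∈M)
  ... | ci≡2 , ¬cfm = chainOrientation-false c i (two∉01Chain c ci≡2) ,
                      chainOrientation-false c (prev i) (¬cfm ∘ Equivalence.from (CyclicallyFirstMaximal⇔01Chain c ci≡2))

clockwise⇒InSome01Chain : (c : Config (suc n)) (O : Orientation (suc n)) → (∃ λ e → lookup O e ≡ false) →
                          (∀ x → lookup O x ≡ true → lookup c x ≡ inDeg O x) →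
                          ∀ k → lookup O k ≡ true → InSome01Chain c k
clockwise⇒InSome01Chain c O (e , Oe≡false) exact = cycle-induction (λ x → lookup O x ≡ true → InSome01Chain c x)
  step {e} λ Oe≡true → contradiction (trans (sym Oe≡true) Oe≡false) λ ()
  where
  value : ∀ x {b} → lookup O (next x) ≡ true → lookup O x ≡ b → lookup c (next x) ≡ b2n b
  value x {b} Onx≡true Ox≡b = begin
    lookup c (next x)                          ≡⟨ exact (next x) Onx≡true ⟩
    inDeg O (next x)                           ≡⟨ inDeg-next O x ⟩
    in-edges (lookup O x) (lookup O (next x))  ≡⟨ cong₂ in-edges Ox≡b Onx≡true ⟩
    b2n b + 0                                  ≡⟨ +-identityʳ (b2n b) ⟩
    b2n b                                      ∎
  step : ∀ x → (lookup O x ≡ true → InSome01Chain c x) →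
         lookup O (next x) ≡ true → InSome01Chain c (next x)
  step x hyp Onx≡true with lookup O x in Ox
  ... | true  = InSome01Chain-step c (value x Onx≡true Ox) (subst (InSome01Chain c) (sym (prev-next x)) (hyp refl))
  ... | false = InSome01Chain-zero c (value x Onx≡true Ox)

chainOrientation-exact : {c : Config (suc n)} {O : Orientation (suc n)} → Dominates c O →
                         (∃ λ e → lookup O e ≡ false) → (∀ x → lookup O x ≡ true → lookup c x ≡ inDeg O x) →
                         chainOrientation c ≡ O
chainOrientation-exact {c = c} {O} dom ccw exact = lookup-ext agree
  where
  agree : ∀ k → lookup (chainOrientation c) k ≡ lookup O k
  agree k with lookup O k in Ok
  ... | true  = chainOrientation-true c k (clockwise⇒InSome01Chain c O ccw exact k Ok)
  ... | false = chainOrientation-false c k λ chain →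
                  contradiction (trans (sym (InSome01Chain⇒clockwise dom chain)) Ok) λ ()

Φ-surjective : (O : Orientation (suc n)) (M : Subset (suc n)) → ProperlyMarked (O , M) →
               ∃ λ c → Stable c × Dominates c O × Φ c ≡ (O , M)
Φ-surjective {n} O M ((e , Oe≡false) , marked-ccw) =
  c , stable , dom , cong₂ _,_ (trans (𝒪∘m≡chainOrientation stable dom) chain≡O) marks≡M
  where
  c : Config (suc n)
  c = tabulate λ i → inDeg O i + b2n (lookup M i)
  lookup-c : ∀ i → lookup c i ≡ inDeg O i + b2n (lookup M i)
  lookup-c i = lookup∘tabulate (λ i → inDeg O i + b2n (lookup M i)) i
  unmarked : ∀ i → lookup M i ≡ false → lookup c i ≡ inDeg O i
  unmarked i Mi≡false =
    trans (lookup-c i) (trans (cong (λ b → inDeg O i + b2n b) Mi≡false) (+-identityʳ (inDeg O i)))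
  stable : Stable c
  stable i with lookup M i in Mi
  ... | false = subst (_< 3) (sym (unmarked i Mi)) (s≤s (inDeg≤2 O i))
  ... | true  =
    subst (_< 3) (sym (trans (lookup-c i) (cong₂ _+_ (trans (inDeg≡ O i) in-degree) (cong b2n Mi)))) ≤-refl
    where
    in-degree : in-edges (lookup O (prev i)) (lookup O i) ≡ 1
    in-degree with marked-ccw i (lookup⇒[]= i M Mi)
    ... | Oi≡false , Oprev≡false = cong₂ in-edges Oprev≡false Oi≡false
  dom : Dominates c O
  dom = dominates λ i → subst (inDeg O i ≤_) (sym (lookup-c i)) (m≤m+n (inDeg O i) (b2n (lookup M i)))
  clockwise-unmarked : ∀ x → lookup O x ≡ true → lookup c x ≡ inDeg O x
  clockwise-unmarked x Ox≡true with lookup M x in Mx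
  ... | false = unmarked x Mx
  ... | true  = contradiction (trans (sym Ox≡true) (proj₁ (marked-ccw x (lookup⇒[]= x M Mx)))) λ ()
  chain≡O : chainOrientation c ≡ O
  chain≡O = chainOrientation-exact dom (e , Oe≡false) clockwise-unmarked
  marks≡M : marks c ≡ M
  marks≡M = lookup-ext λ i → b2n-injective (+-cancelˡ-≡ (inDeg O i) _ _ (begin
    inDeg O i + b2n (lookup (marks c) i)
      ≡⟨ cong (λ O′ → inDeg O′ i + b2n (lookup (marks c) i)) chain≡O ⟨
    inDeg (chainOrientation c) i + b2n (lookup (marks c) i)
      ≡⟨ lookup≡inDeg+marks stable dom i ⟨
    lookup c i
      ≡⟨ lookup-c i ⟩
    inDeg O i + b2n (lookup M i)
      ∎))

sum≡n+∣marks∣ : {c : Config (suc n)} {O : Orientation (suc n)} → Stable c → Dominates c O →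
                sum c ≡ suc n + ∣ marks c ∣
sum≡n+∣marks∣ {n} {c} stable dom = begin
  sum c
    ≡⟨ sum≡∑lookup c ⟩
  ∑[ i < suc n ] lookup c i
    ≡⟨ sum-cong-≗ (lookup≡inDeg+marks stable dom) ⟩
  ∑[ i < suc n ] (inDeg (chainOrientation c) i + b2n (lookup (marks c) i))
    ≡⟨ ∑-distrib-+ (inDeg (chainOrientation c)) (b2n ∘ lookup (marks c)) ⟩
  ∑[ i < suc n ] inDeg (chainOrientation c) i + ∑[ i < suc n ] b2n (lookup (marks c) i)
    ≡⟨ cong₂ _+_ (∑-inDeg (chainOrientation c)) (sym (∣∣≡∑b2n (marks c))) ⟩
  suc n + ∣ marks c ∣
    ∎

level≡∣marks∣ : {c : Config (suc n)} {O : Orientation (suc n)} → Stable c → Dominates c O →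
                level c ≡ + ∣ marks c ∣
level≡∣marks∣ {n} {c} stable dom = begin
  + sum c ℤ.- + suc n                  ≡⟨ cong (λ s → + s ℤ.- + suc n) (sum≡n+∣marks∣ stable dom) ⟩
  + (suc n + ∣ marks c ∣) ℤ.- + suc n  ≡⟨ [+m]-[+n]≡m⊖n (suc n + ∣ marks c ∣) (suc n) ⟩
  (suc n + ∣ marks c ∣) ⊖ suc n        ≡⟨ ⊖-≥ (m≤m+n (suc n) ∣ marks c ∣) ⟩
  + (suc n + ∣ marks c ∣ ∸ suc n)      ≡⟨ cong +_ (m+n∸m≡n (suc n) ∣ marks c ∣) ⟩
  + ∣ marks c ∣                        ∎

weight01*≡clockwiseEdges : {c : Config (suc n)} {O : Orientation (suc n)} → Stable c → Dominates c O →
                           weight01* c ≡ clockwiseEdges (proj₁ (Φ c))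
weight01*≡clockwiseEdges {c = c} stable dom = trans (count≡count-does (inSome01Chain? c) id)
  (cong clockwiseEdges (sym (𝒪∘m≡chainOrientation stable dom)))

-- Recurrence

by-cases₂ : (P : Fin n → Set ℓ) (i j : Fin n) → P i → P j → (∀ k → k ≢ i → k ≢ j → P k) → ∀ k → P k
by-cases₂ P i j Pi Pj Pk k with k ≟ᶠ i | k ≟ᶠ j
... | yes refl | _        = Pi
... | no _     | yes refl = Pj
... | no k≢i   | no k≢j   = Pk k k≢i k≢j

by-cases₃ : (P : Fin n → Set ℓ) (i j l : Fin n) → P i → P j → P l →
            (∀ k → k ≢ i → k ≢ j → k ≢ l → P k) → ∀ k → P k
by-cases₃ P i j l Pi Pj Pl Pk k with k ≟ᶠ i | k ≟ᶠ j | k ≟ᶠ l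
... | yes refl | _        | _        = Pi
... | no _     | yes refl | _        = Pj
... | no _     | no _     | yes refl = Pl
... | no k≢i   | no k≢j   | no k≢l   = Pk k k≢i k≢j k≢l

Star-preserves : {A : Set ℓ} {T : A → A → Set ℓ} (Q : A → Set ℓ) →
                 (∀ {x y} → T x y → Q x → Q y) → ∀ {x y} → Star T x y → Q x → Q y
Star-preserves Q step = fold (λ x y → Q x → Q y) (λ t f → f ∘ step t) id

Stable-update : {c : Config n} (j : Fin n) {x : ℕ} → Stable c → x < 3 → Stable (c [ j ]≔ x)
Stable-update {c = c} j {x} stable x<3 k with k ≟ᶠ j
... | yes refl = subst (_< 3) (sym (lookup∘update k c x)) x<3
... | no k≢j   = subst (_< 3) (sym (lookup∘update′ k≢j c x)) (stable k)

add-grain-≥ : (c : Config n) (i k : Fin n) → lookup c k ≤ lookup (updateAt c i suc) k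
add-grain-≥ c i k with k ≟ᶠ i
... | yes refl = subst (lookup c k ≤_) (sym (lookup∘updateAt k c)) (n≤1+n (lookup c k))
... | no k≢i   = ≤-reflexive (sym (lookup∘updateAt′ k i k≢i c))

toppled : Config n → Fin n → (sPrev sNext sSink : Bool) → Config n
toppled c i a b s = updateAt (updateAt (updateAt c i (λ x → x ∸ (b2n a + b2n b + b2n s)))
                                       (prev i) (λ x → x + b2n a))
                             (next i) (λ x → x + b2n b)

module _ (c : Config (3 + n)) (i : Fin (3 + n)) (a b s : Bool) where

  private
    c₁ = updateAt c i (λ x → x ∸ (b2n a + b2n b + b2n s))
    c₂ = updateAt c₁ (prev i) (λ x → x + b2n a)

  toppled-self : lookup (toppled c i a b s) i ≡ lookup c i ∸ (b2n a + b2n b + b2n s)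
  toppled-self = begin
    lookup (toppled c i a b s) i          ≡⟨ lookup∘updateAt′ i (next i) (≢-sym (next≢ i)) c₂ ⟩
    lookup c₂ i                           ≡⟨ lookup∘updateAt′ i (prev i) (≢-sym (prev≢ i)) c₁ ⟩
    lookup c₁ i                           ≡⟨ lookup∘updateAt i c ⟩
    lookup c i ∸ (b2n a + b2n b + b2n s)  ∎

  toppled-prev : lookup (toppled c i a b s) (prev i) ≡ lookup c (prev i) + b2n a
  toppled-prev = begin
    lookup (toppled c i a b s) (prev i)  ≡⟨ lookup∘updateAt′ (prev i) (next i) (prev≢next i) c₂ ⟩
    lookup c₂ (prev i)                   ≡⟨ lookup∘updateAt (prev i) c₁ ⟩
    lookup c₁ (prev i) + b2n a           ≡⟨ cong (_+ b2n a) (lookup∘updateAt′ (prev i) i (prev≢ i) c) ⟩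
    lookup c (prev i) + b2n a            ∎

  toppled-next : lookup (toppled c i a b s) (next i) ≡ lookup c (next i) + b2n b
  toppled-next = begin
    lookup (toppled c i a b s) (next i)  ≡⟨ lookup∘updateAt (next i) c₂ ⟩
    lookup c₂ (next i) + b2n b           ≡⟨ cong (_+ b2n b) (lookup∘updateAt′ (next i) (prev i) next≢prev c₁) ⟩
    lookup c₁ (next i) + b2n b           ≡⟨ cong (_+ b2n b) (lookup∘updateAt′ (next i) i (next≢ i) c) ⟩
    lookup c (next i) + b2n b            ∎

    where next≢prev = ≢-sym (prev≢next i)

  toppled-other : ∀ k → k ≢ i → k ≢ prev i → k ≢ next i → lookup (toppled c i a b s) k ≡ lookup c k
  toppled-other k k≢i k≢prev k≢next = begin
    lookup (toppled c i a b s) k  ≡⟨ lookup∘updateAt′ k (next i) k≢next c₂ ⟩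
    lookup c₂ k                   ≡⟨ lookup∘updateAt′ k (prev i) k≢prev c₁ ⟩
    lookup c₁ k                   ≡⟨ lookup∘updateAt′ k i k≢i c ⟩
    lookup c k                    ∎

topple-around : (x d : Config (3 + n)) (i : Fin (3 + n)) (a b s : Bool) → 3 ≤ lookup x i →
                lookup x i ∸ (b2n a + b2n b + b2n s) ≡ lookup d i →
                lookup x (prev i) + b2n a ≡ lookup d (prev i) →
                lookup x (next i) + b2n b ≡ lookup d (next i) →
                (∀ k → k ≢ i → k ≢ prev i → k ≢ next i → lookup x k ≡ lookup d k) → Topple x d
topple-around x d i a b s 3≤xi at-self at-prev at-next at-other = subst (Topple x) (lookup-ext
  (by-cases₃ (λ k → lookup (toppled x i a b s) k ≡ lookup d k) i (prev i) (next i)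
    (trans (toppled-self x i a b s) at-self)
    (trans (toppled-prev x i a b s) at-prev)
    (trans (toppled-next x i a b s) at-next)
    (λ k k≢i k≢prev k≢next →
       trans (toppled-other x i a b s k k≢i k≢prev k≢next) (at-other k k≢i k≢prev k≢next))))
  (topple i 3≤xi a b s)

reorient : Orientation n → Fin n → (sPrev sNext : Bool) → Orientation n
reorient O i a b = (O [ prev i ]≔ (not a ∧ lookup O (prev i))) [ i ]≔ (b ∨ lookup O i)

module _ (O : Orientation (3 + n)) (i : Fin (3 + n)) (a b : Bool) where

  private
    O₁ = O [ prev i ]≔ (not a ∧ lookup O (prev i))

  reorient-self : lookup (reorient O i a b) i ≡ b ∨ lookup O i
  reorient-self = lookup∘update i O₁ (b ∨ lookup O i)

  reorient-prev : lookup (reorient O i a b) (prev i) ≡ not a ∧ lookup O (prev i)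
  reorient-prev = trans (lookup∘update′ (prev≢ i) O₁ _) (lookup∘update (prev i) O _)

  reorient-other : ∀ k → k ≢ i → k ≢ prev i → lookup (reorient O i a b) k ≡ lookup O k
  reorient-other k k≢i k≢prev = trans (lookup∘update′ k≢i O₁ _) (lookup∘update′ k≢prev O _)

  inDeg-reorient-self : inDeg (reorient O i a b) i ≡ in-edges (not a ∧ lookup O (prev i)) (b ∨ lookup O i)
  inDeg-reorient-self = trans (inDeg≡ (reorient O i a b) i) (cong₂ in-edges reorient-prev reorient-self)

  inDeg-reorient-prev : inDeg (reorient O i a b) (prev i) ≤ inDeg O (prev i) + b2n a
  inDeg-reorient-prev = subst₂ _≤_
    (sym (trans (inDeg≡ (reorient O i a b) (prev i))
                (cong₂ in-edges (reorient-other (prev (prev i)) (prev²≢ i) (prev≢ (prev i))) reorient-prev)))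
    (cong (_+ b2n a) (sym (inDeg≡ O (prev i))))
    (bound (b2n (lookup O (prev (prev i)))) (lookup O (prev i)) a)
    where
    bound : ∀ u y a → u + b2n (not (not a ∧ y)) ≤ u + b2n (not y) + b2n a
    bound u y false = m≤m+n (u + b2n (not y)) 0
    bound u y true  = +-monoˡ-≤ 1 (m≤m+n u (b2n (not y)))

  inDeg-reorient-next : inDeg (reorient O i a b) (next i) ≤ inDeg O (next i) + b2n b
  inDeg-reorient-next = subst₂ _≤_
    (sym (trans (inDeg-next (reorient O i a b) i)
                (cong₂ in-edges reorient-self (reorient-other (next i) (next≢ i) (≢-sym (prev≢next i))))))
    (cong (_+ b2n b) (sym (inDeg-next O i)))
    (bound (lookup O i) (b2n (not (lookup O (next i)))) b)
    where
    bound : ∀ y v b → b2n (b ∨ y) + v ≤ b2n y + v + b2n b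
    bound y v false = m≤m+n (b2n y + v) 0
    bound y v true  = subst (suc v ≤_) (+-comm 1 (b2n y + v)) (s≤s (m≤n+m v (b2n y)))

  inDeg-reorient-other : ∀ k → k ≢ i → k ≢ prev i → k ≢ next i →
                         inDeg (reorient O i a b) k ≡ inDeg O k
  inDeg-reorient-other k k≢i k≢prev k≢next = trans (inDeg-update O₁ i _ k k≢i k≢next)
    (inDeg-update O (prev i) _ k k≢prev (subst (k ≢_) (sym (next-prev i)) k≢i))

topple-dominated : {c c′ : Config (3 + n)} {O : Orientation (3 + n)} → Topple c c′ → Dominates c O →
                   ∃ (Dominates c′)
topple-dominated {c = c} {O = O} (topple i 3≤ci a b s) dom =
  O′ , dominates (by-cases₃ (λ k → inDeg O′ k ≤ lookup c′ k) i (prev i) (next i) at-self at-prev at-next at-other)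
  where
  O′ = reorient O i a b
  c′ = toppled c i a b s
  bound : ∀ a b s x y → in-edges (not a ∧ x) (b ∨ y) + (b2n a + b2n b + b2n s) ≤ 3
  bound true  true  s x y = s≤s (s≤s (b2n≤1 s))
  bound true  false s x y = +-mono-≤ (b2n≤1 (not y)) (s≤s (b2n≤1 s))
  bound false true  s x y = +-mono-≤ (+-mono-≤ (b2n≤1 x) (z≤n {0})) (s≤s (b2n≤1 s))
  bound false false s x y = +-mono-≤ (+-mono-≤ (b2n≤1 x) (b2n≤1 (not y))) (b2n≤1 s)
  at-self : inDeg O′ i ≤ lookup c′ i
  at-self = subst (inDeg O′ i ≤_) (sym (toppled-self c i a b s)) (m+n≤o⇒m≤o∸n (inDeg O′ i) (≤-trans
    (subst (λ d → d + (b2n a + b2n b + b2n s) ≤ 3) (sym (inDeg-reorient-self O i a b))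
           (bound a b s (lookup O (prev i)) (lookup O i)))
    3≤ci))
  at-prev : inDeg O′ (prev i) ≤ lookup c′ (prev i)
  at-prev = subst (inDeg O′ (prev i) ≤_) (sym (toppled-prev c i a b s))
    (≤-trans (inDeg-reorient-prev O i a b) (+-monoˡ-≤ (b2n a) (inDeg≤ dom (prev i))))
  at-next : inDeg O′ (next i) ≤ lookup c′ (next i)
  at-next = subst (inDeg O′ (next i) ≤_) (sym (toppled-next c i a b s))
    (≤-trans (inDeg-reorient-next O i a b) (+-monoˡ-≤ (b2n b) (inDeg≤ dom (next i))))
  at-other : ∀ k → k ≢ i → k ≢ prev i → k ≢ next i → inDeg O′ k ≤ lookup c′ k
  at-other k k≢i k≢prev k≢next = subst₂ _≤_ (sym (inDeg-reorient-other O i a b k k≢i k≢prev k≢next))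
    (sym (toppled-other c i a b s k k≢i k≢prev k≢next)) (inDeg≤ dom k)

chainStep-dominated : {c c′ : Config (3 + n)} → ChainStep c c′ → ∃ (Dominates c) → ∃ (Dominates c′)
chainStep-dominated {c = c} (_ , i , topples , _) (O , dom) =
  Star-preserves (λ d → ∃ (Dominates d)) (λ t (_ , dom) → topple-dominated t dom) topples
    (O , Dominates-mono (add-grain-≥ c i) dom)

chainSteps-dominated : {c c′ : Config (3 + n)} → Star ChainStep c c′ →
                       ∃ (Dominates c) → ∃ (Dominates c′)
chainSteps-dominated = Star-preserves (λ d → ∃ (Dominates d)) chainStep-dominated

chainSteps-stable : {c c′ : Config n} → Star ChainStep c c′ → Stable c → Stable c′
chainSteps-stable = Star-preserves Stable λ (_ , _ , _ , stable′) _ → stable′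

allTwo : Config n
allTwo {n} = replicate n 2

allTwo-dominated : ∃ (Dominates (allTwo {suc n}))
allTwo-dominated {n} =
  replicate (suc n) false , dominates λ k → subst₂ _≤_ (sym (inDeg-ccw k)) (sym (lookup-replicate k 2)) (s≤s z≤n)

deficit : Config n → ℕ
deficit {n} c = ∑[ k < n ] (2 ∸ lookup c k)

deficit-raise : (c c′ : Config (suc n)) (j : Fin (suc n)) (x : ℕ) →
                (∀ k → k ≢ j → lookup c k ≡ lookup c′ k) → lookup c′ j ≡ x + lookup c j → lookup c′ j ≤ 2 →
                x + deficit c′ ≡ deficit c
deficit-raise c c′ j x agree c′j≡x+cj c′j≤2 = +-cancelˡ-≡ r (x + deficit c′) (deficit c) (begin
  r + (x + deficit c′)           ≡⟨ x∙yz≈y∙xz r x (deficit c′) ⟩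
  x + (r + deficit c′)           ≡⟨ +-assoc x r (deficit c′) ⟨
  x + r + deficit c′             ≡⟨ cong (_+ deficit c′) gap ⟩
  (2 ∸ lookup c j) + deficit c′  ≡⟨ ∑-update (λ k → 2 ∸ lookup c k) (λ k → 2 ∸ lookup c′ k) j
                                             (λ k k≢j → cong (2 ∸_) (agree k k≢j)) ⟩
  r + deficit c                  ∎)
  where
  r = 2 ∸ lookup c′ j
  gap : x + r ≡ 2 ∸ lookup c j
  gap = begin
    x + (2 ∸ lookup c′ j)       ≡⟨ cong (λ y → x + (2 ∸ y)) (trans c′j≡x+cj (+-comm x (lookup c j))) ⟩
    x + (2 ∸ (lookup c j + x))  ≡⟨ cong (λ y → x + y) (∸-+-assoc 2 (lookup c j) x) ⟨
    x + (2 ∸ lookup c j ∸ x)    ≡⟨ m+[n∸m]≡n (m+n≤o⇒m≤o∸n x (subst (_≤ 2) c′j≡x+cj c′j≤2)) ⟩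
    2 ∸ lookup c j              ∎

fill : ∀ d (c : Config (suc n)) → deficit c ≡ d → Stable c → Star ChainStep c allTwo
fill d c deficit≡d stable with any? (λ i → lookup c i <? 2)
... | no ≥2 = subst (Star ChainStep c) (lookup-ext all-two) ε
  where
  all-two : ∀ k → lookup c k ≡ lookup allTwo k
  all-two k = trans (≤-antisym (s≤s⁻¹ (stable k)) (≮⇒≥ (≥2 ∘ (k ,_)))) (sym (lookup-replicate k 2))
... | yes (i , ci<2) = (stable , i , ε , stable′) ◅ fill′ d (trans smaller deficit≡d)
  where
  c′ = updateAt c i suc
  stable′ : Stable c′
  stable′ k with k ≟ᶠ i
  ... | yes refl = subst (_< 3) (sym (lookup∘updateAt k c)) (s≤s ci<2)
  ... | no k≢i   = subst (_< 3) (sym (lookup∘updateAt′ k i k≢i c)) (stable k)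
  smaller : suc (deficit c′) ≡ deficit c
  smaller = deficit-raise c c′ i 1 (λ k k≢i → sym (lookup∘updateAt′ k i k≢i c)) (lookup∘updateAt i c)
                          (subst (_≤ 2) (sym (lookup∘updateAt i c)) ci<2)
  fill′ : ∀ d → suc (deficit c′) ≡ d → Star ChainStep c′ allTwo
  fill′ (suc d) eq = fill d c′ (suc-injective eq) stable′

topple-back : (c : Config (3 + n)) (v : Fin (3 + n)) → lookup c v ≡ 2 → Topple (c [ v ]≔ 3) c
topple-back c v cv≡2 = topple-around (c [ v ]≔ 3) c v false false true (≤-reflexive (sym (lookup∘update v c 3)))
  (trans (cong (_∸ 1) (lookup∘update v c 3)) (sym cv≡2))
  (trans (+-identityʳ _) (lookup∘update′ (prev≢ v) c 3))
  (trans (+-identityʳ _) (lookup∘update′ (next≢ v) c 3))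
  (λ k k≢v _ _ → lookup∘update′ k≢v c 3)

record Predecessor (c : Config n) : Set where
  field
    config      : Config n
    step        : ChainStep config c
    orientation : Orientation n
    dominated   : Dominates config orientation
    non-one     : ∃ λ k → lookup config k ≢ 1

SmallerPredecessor : Config n → Set
SmallerPredecessor c = Σ (Predecessor c) λ p → suc (deficit (Predecessor.config p)) ≡ deficit c

module _ {c : Config (3 + n)} (stable : Stable c) {j : Fin (3 + n)} (cprev≡2 : lookup c (prev j) ≡ 2) where

  backward-step : (b : Bool) → lookup c j + b2n b ≡ 1 → (d : Config (3 + n)) → Stable d →
                  lookup d (next j) + b2n b ≡ lookup c (next j) →
                  (∀ {k} → k ≢ next j → lookup d k ≡ lookup c k) → ChainStep (d [ j ]≔ 2) c
  backward-step b cj+b≡1 d stable-d d-next d-other =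
    Stable-update {c = d} j stable-d ≤-refl , j , topple-j ◅ topple-back c (prev j) cprev≡2 ◅ ε , stable
    where
    x = updateAt (d [ j ]≔ 2) j suc
    j≢prev = ≢-sym (prev≢ j)
    next≢prev = ≢-sym (prev≢next j)
    x-self : lookup x j ≡ 3
    x-self = trans (lookup∘updateAt j (d [ j ]≔ 2)) (cong suc (lookup∘update j d 2))
    x-other : ∀ {k} → k ≢ j → lookup x k ≡ lookup d k
    x-other k≢j = trans (lookup∘updateAt′ _ j k≢j (d [ j ]≔ 2)) (lookup∘update′ k≢j d 2)
    left : ∀ b {v} → v + b2n b ≡ 1 → 3 ∸ (1 + b2n b + 1) ≡ v
    left false v+0≡1 = sym (trans (sym (+-identityʳ _)) v+0≡1)
    left true  v+1≡1 = sym (+-cancelʳ-≡ 1 _ 0 v+1≡1)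
    topple-j : Topple x (c [ prev j ]≔ 3)
    topple-j = topple-around x (c [ prev j ]≔ 3) j true b true (≤-reflexive (sym x-self))
      (trans (cong (_∸ (1 + b2n b + 1)) x-self) (trans (left b cj+b≡1) (sym (lookup∘update′ j≢prev c 3))))
      (trans (cong (_+ 1) (trans (x-other (prev≢ j)) (trans (d-other (prev≢next j)) cprev≡2)))
             (sym (lookup∘update (prev j) c 3)))
      (trans (cong (_+ b2n b) (x-other (next≢ j))) (trans d-next (sym (lookup∘update′ next≢prev c 3))))
      (λ k k≢j k≢prev k≢next → trans (x-other k≢j) (trans (d-other k≢next) (sym (lookup∘update′ k≢prev c 3))))

  predecessor-1 : {O : Orientation (3 + n)} → Dominates c O → lookup c j ≡ 1 → SmallerPredecessor c
  predecessor-1 {O} dom cj≡1 = record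
    { config      = c [ j ]≔ 2
    ; step        = backward-step false (trans (+-identityʳ _) cj≡1) c stable (+-identityʳ _) (λ _ → refl)
    ; orientation = O
    ; dominated   = Dominates-mono c≤c″ dom
    ; non-one     = j , lookup≢ (c [ j ]≔ 2) (lookup∘update j c 2) λ ()
    } , deficit-raise c (c [ j ]≔ 2) j 1 (λ k k≢j → sym (lookup∘update′ k≢j c 2))
                      (trans (lookup∘update j c 2) (cong suc (sym cj≡1))) (≤-reflexive (lookup∘update j c 2))
    where
    c≤c″ : ∀ k → lookup c k ≤ lookup (c [ j ]≔ 2) k
    c≤c″ k with k ≟ᶠ j
    ... | yes refl = subst₂ _≤_ (sym cj≡1) (sym (lookup∘update k c 2)) (s≤s z≤n)
    ... | no k≢j   = ≤-reflexive (sym (lookup∘update′ k≢j c 2))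

  predecessor-0 : {O : Orientation (3 + n)} → Dominates c O → lookup c j ≡ 0 → SmallerPredecessor c
  predecessor-0 {O} dom cj≡0 with lookup c (next j) in cnext | zero⇒next-in-degree dom cj≡0
  ... | suc u | next-in-degree = record
    { config      = c″
    ; step        = backward-step true (cong (_+ 1) cj≡0) c₁ stable₁
                      (trans (cong (_+ 1) (lookup∘update (next j) c u)) (trans (+-comm u 1) (sym cnext)))
                      (λ k≢next → lookup∘update′ k≢next c u)
    ; orientation = O′
    ; dominated   = dominates (by-cases₂ (λ k → inDeg O′ k ≤ lookup c″ k) j (next j) at-j at-next at-other)
    ; non-one     = j , lookup≢ c″ (lookup∘update j c₁ 2) λ ()
    } , suc-injective (trans
          (deficit-raise c₁ c″ j 2 (λ k k≢j → sym (lookup∘update′ k≢j c₁ 2))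
                         (trans (lookup∘update j c₁ 2) (cong (λ v → 2 + v) (sym c₁j≡0)))
                         (≤-reflexive (lookup∘update j c₁ 2)))
          (sym (deficit-raise c₁ c (next j) 1 (λ k k≢next → lookup∘update′ k≢next c u)
                              (trans cnext (cong suc (sym (lookup∘update (next j) c u))))
                              (s≤s⁻¹ (stable (next j))))))
    where
    c₁ = c [ next j ]≔ u
    c″ = c₁ [ j ]≔ 2
    c₁j≡0 : lookup c₁ j ≡ 0
    c₁j≡0 = trans (lookup∘update′ (≢-sym (next≢ j)) c u) cj≡0
    stable₁ : Stable c₁
    stable₁ = Stable-update {c = c} (next j) stable (<-trans (n<1+n u) (subst (_< 3) cnext (stable (next j))))
    O′ = O [ j ]≔ false
    at-j : inDeg O′ j ≤ lookup c″ j
    at-j = subst (inDeg O′ j ≤_) (sym (lookup∘update j c₁ 2)) (inDeg≤2 O′ j)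
    at-next : inDeg O′ (next j) ≤ lookup c″ (next j)
    at-next = subst₂ _≤_
      (sym (trans (inDeg-next O′ j) (cong₂ in-edges (lookup∘update j O false) (lookup∘update′ (next≢ j) O false))))
      (sym (trans (lookup∘update′ (next≢ j) c₁ 2) (lookup∘update (next j) c u)))
      (s≤s⁻¹ next-in-degree)
    at-other : ∀ k → k ≢ j → k ≢ next j → inDeg O′ k ≤ lookup c″ k
    at-other k k≢j k≢next = subst₂ _≤_ (sym (inDeg-update O j false k k≢j k≢next))
      (sym (trans (lookup∘update′ k≢j c₁ 2) (lookup∘update′ k≢next c u))) (inDeg≤ dom k)

all-ones-predecessor : {c : Config (3 + n)} → Stable c → (∀ k → lookup c k ≡ 1) → (j : Fin (3 + n)) →
                       Predecessor c
all-ones-predecessor {n} {c} stable ones j = record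
  { config      = c″
  ; step        = stable″ , next j , topple-next ◅ ε , stable
  ; orientation = O″
  ; dominated   = dominates (by-cases₂ (λ k → inDeg O″ k ≤ lookup c″ k) j (next j) at-j at-next at-other)
  ; non-one     = j , lookup≢ c″ (lookup∘update j c₁ 0) λ ()
  }
  where
  c₁ = c [ next j ]≔ 2
  c″ = c₁ [ j ]≔ 0
  x = updateAt c″ (next j) suc
  stable″ : Stable c″
  stable″ = Stable-update {c = c₁} j (Stable-update {c = c} (next j) stable ≤-refl) (s≤s z≤n)
  c″-next : lookup c″ (next j) ≡ 2
  c″-next = trans (lookup∘update′ (next≢ j) c₁ 0) (lookup∘update (next j) c 2)
  x-other : ∀ {k} → k ≢ j → k ≢ next j → lookup x k ≡ lookup c k
  x-other k≢j k≢next =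
    trans (lookup∘updateAt′ _ (next j) k≢next c″) (trans (lookup∘update′ k≢j c₁ 0) (lookup∘update′ k≢next c 2))
  x-next : lookup x (next j) ≡ 3
  x-next = trans (lookup∘updateAt (next j) c″) (cong suc c″-next)
  x-j : lookup x j ≡ 0
  x-j = trans (lookup∘updateAt′ j (next j) (≢-sym (next≢ j)) c″) (lookup∘update j c₁ 0)
  topple-next : Topple x c
  topple-next = topple-around x c (next j) true false true (≤-reflexive (sym x-next))
    (trans (cong (_∸ 2) x-next) (sym (ones (next j))))
    (trans (cong (λ k → lookup x k + 1) (prev-next j)) (trans (cong (_+ 1) x-j) (sym (ones (prev (next j))))))
    (trans (+-identityʳ _) (x-other (next²≢ j) (next≢ (next j))))
    (λ k k≢next k≢prev _ → x-other (λ k≡j → k≢prev (trans k≡j (sym (prev-next j)))) k≢next)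
  ccw = replicate (3 + n) false
  O″ = ccw [ j ]≔ true
  at-j : inDeg O″ j ≤ lookup c″ j
  at-j = ≤-reflexive (trans (inDeg≡ O″ j) (trans
    (cong₂ in-edges (trans (lookup∘update′ (prev≢ j) ccw true) (lookup-replicate (prev j) false))
                    (lookup∘update j ccw true))
    (sym (lookup∘update j c₁ 0))))
  at-next : inDeg O″ (next j) ≤ lookup c″ (next j)
  at-next = subst (inDeg O″ (next j) ≤_) (sym c″-next) (inDeg≤2 O″ (next j))
  at-other : ∀ k → k ≢ j → k ≢ next j → inDeg O″ k ≤ lookup c″ k
  at-other k k≢j k≢next = ≤-reflexive (trans (inDeg-update ccw j true k k≢j k≢next) (trans (inDeg-ccw k)
    (sym (trans (lookup∘update′ k≢j c₁ 0) (trans (lookup∘update′ k≢next c 2) (ones k))))))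

reachable-with-non-one : ∀ d (c : Config (3 + n)) {O : Orientation (3 + n)} → deficit c ≡ d →
                         Stable c → Dominates c O → (∃ λ k → lookup c k ≢ 1) → Star ChainStep allTwo c
reachable-with-non-one d c deficit≡d stable dom (k , ck≢1)
  with any? (λ j → (lookup c j <? 2) ×-dec (lookup c (prev j) ≟ 2))
... | yes (j , cj<2 , cprev≡2) = via (case-split (lookup c j) refl cj<2) d deficit≡d
  where
  case-split : ∀ v → lookup c j ≡ v → v < 2 → SmallerPredecessor c
  case-split 0 cj≡0 _ = predecessor-0 stable cprev≡2 dom cj≡0
  case-split 1 cj≡1 _ = predecessor-1 stable cprev≡2 dom cj≡1
  case-split (suc (suc _)) _ (s≤s (s≤s ()))
  via : SmallerPredecessor c → ∀ d → deficit c ≡ d → Star ChainStep allTwo c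
  via (p , smaller) zero    deficit≡0 = case trans smaller deficit≡0 of λ ()
  via (p , smaller) (suc d) deficit≡d =
    reachable-with-non-one d config (suc-injective (trans smaller deficit≡d)) (proj₁ step) dominated non-one
      ◅◅ (step ◅ ε)
    where open Predecessor p
-- Otherwise a single 2 forces c = all-2, and without any 2 the configuration c ≤ 1 has a 0, so dominates nothing.
... | no no-move with any? (λ j → lookup c j ≟ 2)
...   | yes (j , cj≡2) =
  subst (Star ChainStep allTwo) (lookup-ext λ x → trans (lookup-replicate x 2) (sym (all-two x))) ε
  where
  all-two : ∀ x → lookup c x ≡ 2
  all-two = cycle-induction (λ x → lookup c x ≡ 2) step cj≡2
    where
    step : ∀ x → lookup c x ≡ 2 → lookup c (next x) ≡ 2
    step x cx≡2 = ≤-antisym (s≤s⁻¹ (stable (next x)))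
      (≮⇒≥ λ cnext<2 → no-move (next x , cnext<2 , trans (cong (lookup c) (prev-next x)) cx≡2))
...   | no no-two = contradiction ck≡0 (≤1⇒no-zero dom ≤1 k)
  where
  ≤1 : ∀ x → lookup c x ≤ 1
  ≤1 x = s≤s⁻¹ (≤∧≢⇒< (s≤s⁻¹ (stable x)) (no-two ∘ (x ,_)))
  ck≡0 : lookup c k ≡ 0
  ck≡0 = n≤0⇒n≡0 (s≤s⁻¹ (≤∧≢⇒< (≤1 k) ck≢1))

reachable : {c : Config (3 + n)} {O : Orientation (3 + n)} → Stable c → Dominates c O → Star ChainStep allTwo c
reachable {n} {c} stable dom with any? (λ k → ¬? (lookup c k ≟ 1))
... | yes non-one = reachable-with-non-one _ c refl stable dom non-one
-- The all-ones configuration has no predecessor of smaller deficit, but one containing a 0.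
... | no all-one  = reachable-with-non-one _ config refl (proj₁ step) dominated non-one ◅◅ (step ◅ ε)
  where
  open Predecessor
    (all-ones-predecessor {c = c} stable (λ k → decidable-stable (lookup c k ≟ 1) (all-one ∘ (k ,_))) fzero)

recurrent⇒dominated : {c : Config (3 + n)} → Recurrent c → ∃ (Dominates c)
recurrent⇒dominated {c = c} (stable , returns) =
  chainSteps-dominated (returns allTwo (fill _ c refl stable)) allTwo-dominated

dominated⇒recurrent : {c : Config (3 + n)} {O : Orientation (3 + n)} → Stable c → Dominates c O → Recurrent c
dominated⇒recurrent stable dom =
  stable , λ c′ c⇝c′ → fill _ c′ refl (chainSteps-stable c⇝c′ stable) ◅◅ reachable stable dom

theorem3p8 : (n : ℕ) → 3 ≤ n →
      ((c : Config n) → Recurrent c → ProperlyMarked (Φ c))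
    × ((c d : Config n) → Recurrent c → Recurrent d → Φ c ≡ Φ d → c ≡ d)
    × ((om : MarkedOrientation n) → ProperlyMarked om →
         ∃ (λ (c : Config n) → Recurrent c × Φ c ≡ om))
    × ((c : Config n) → Recurrent c →
         (level c ≡ + ∣ proj₂ (Φ c) ∣) × (weight01* c ≡ clockwiseEdges (proj₁ (Φ c))))
theorem3p8 _ (s≤s (s≤s (s≤s z≤n))) =
    (λ c rec → let _ , dom = recurrent⇒dominated rec in Φ-properlyMarked (proj₁ rec) dom)
  , (λ c d rec-c rec-d → let _ , dom-c = recurrent⇒dominated rec-c
                             _ , dom-d = recurrent⇒dominated rec-d
                         in Φ-injective (proj₁ rec-c) dom-c (proj₁ rec-d) dom-d)
  , (λ (O , M) marked → let c , stable , dom , Φc≡OM = Φ-surjective O M marked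
                        in c , dominated⇒recurrent stable dom , Φc≡OM)
  , (λ c rec → let _ , dom = recurrent⇒dominated rec
               in level≡∣marks∣ (proj₁ rec) dom , weight01*≡clockwiseEdges (proj₁ rec) dom)
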